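{- Let $A=[A_1,\dots,A_n]$ be an $n\times n\times n$ alternating sign hypermatrix (ASHM) with $n>3$, and let $L=L(A)=1A_1+2A_2+\cdots+nA_n$. Then the second row, the second-to-last row, the second column and the second-to-last column of $L$ are not constant (i.e., not all entries equal).
   Context: An $n\times n$ alternating sign matrix (ASM) is a $(0,\pm1)$-matrix whose rows and columns each have nonzeros alternating in sign beginning and ending with $+1$. For an $n\times n\times n$ hypermatrix $A=[a_{ijk}]$, the horizontal planes are $A_k=[a_{ijk}]_{i,j}$, written $A=[A_1,\dots,A_n]$, and lines are obtained by fixing two indices and varying the third. $A$ is an ASHM if every line has nonzeros alternating in sign beginning and ending with $+1$. -}

module Defs where

open import Data.Nat using (ℕ; zero; suc)
open import Data.Fin using (Fin; toℕ)
open import Data.Integer using (ℤ; +_; -[1+_]; _+_; _*_; 0ℤ; 1ℤ)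
open import Data.List using (List; []; _∷_; map; foldr; filter)
open import Data.List.Relation.Unary.All using (All)
open import Data.Sum using (_⊎_)
open import Data.Product using (Σ; _×_)
open import Relation.Nullary using (¬_)
open import Relation.Binary.PropositionalEquality using (_≡_)
open import Data.Integer.Properties using (_≟_)
open import Relation.Nullary.Decidable using (¬?)
open import Data.List.Base using (allFin)

IsSign : ℤ → Set
IsSign x = (x ≡ 0ℤ) ⊎ (x ≡ 1ℤ) ⊎ (x ≡ -[1+ 0 ])

nonzeros : List ℤ → List ℤ
nonzeros = filter (λ x → ¬? (x ≟ 0ℤ))

data AltPlus : List ℤ → Set where
  single : AltPlus (1ℤ ∷ [])
  step   : ∀ {xs} → AltPlus xs → AltPlus (1ℤ ∷ -[1+ 0 ] ∷ xs)

AltSignLine : List ℤ → Set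
AltSignLine xs = All IsSign xs × AltPlus (nonzeros xs)

line : ∀ {n} → (Fin n → ℤ) → List ℤ
line {n} f = map f (allFin n)

-- n × n × n hypermatrix, A i j k = a_{ijk}; horizontal plane A_k = [a_{ijk}]_{i,j}.
HyperMatrix : ℕ → Set
HyperMatrix n = Fin n → Fin n → Fin n → ℤ

IsASHM : ∀ {n} → HyperMatrix n → Set
IsASHM {n} A =
  (∀ (j k : Fin n) → AltSignLine (line (λ i → A i j k))) ×
  (∀ (i k : Fin n) → AltSignLine (line (λ j → A i j k))) ×
  (∀ (i j : Fin n) → AltSignLine (line (λ k → A i j k)))

-- L(A) = 1·A_1 + 2·A_2 + ... + n·A_n, i.e. L_{ij} = Σ_k k · a_{ijk} (k 1-based).
L : ∀ {n} → HyperMatrix n → Fin n → Fin n → ℤ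
L {n} A i j = foldr _+_ 0ℤ (map (λ k → (+ suc (toℕ k)) * A i j k) (allFin n))

Constant : ∀ {n} → (Fin n → ℤ) → Set
Constant {n} v = ∀ (j j′ : Fin n) → v j ≡ v j′

-- Row/column indices (0-based): the second index is 1, the second-to-last is n ∸ 2.
open import Data.Nat using (_<_; _∸_; s≤s; z≤n)
open import Data.Fin using (fromℕ<)

secondIdx : ∀ n → 3 < n → Fin n
secondIdx (suc (suc n)) _ = Data.Fin.suc Data.Fin.zero
secondIdx (suc zero) (s≤s ())
secondIdx zero ()

secondLastIdx : ∀ n → 3 < n → Fin n
secondLastIdx (suc (suc n)) _ = Data.Fin.inject₁ (Data.Fin.fromℕ n)
secondLastIdx (suc zero) (s≤s ())
secondLastIdx zero ()

module Submission where

-- Rows of L are treated first; columns follow by transposing the first two indices.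
-- Let s be the second (resp. second-to-last) index, e the first (resp. last) one, and
-- write E y k = a_{e y k}, P y k = a_{s y k} for a boundary plane and its neighbour.
-- Row s of L is y ↦ weight (P y), where weight f = Σ_k (k+1)·f(k).
--  (1) The first two entries (a , b) of an alternating sign line form an opening pair:
--      a ≠ -1, a = 0 ⇒ b ≠ -1 and a = 1 ⇒ b ≠ 1; by reversal so do the last two.
--  (2) An alternating sign line without -1 is the indicator of one position p, and
--      its weight is p+1, so the weight determines p.
--  (3) If (f k , g k) is an opening pair for every k, f is the indicator of p and g is
--      an alternating sign line of the same weight as f, then g(p) = -1.
-- The x-lines make every (E y k , P y k) an opening pair and the y-lines of P make
-- (P first , P second) and (P last , P second-to-last) opening pairs.  If row s were
-- constant, (2) puts the 1 of P first and of P last at the same p, (3) gives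
-- P second p = P second-to-last p = -1, hence E second p = E second-to-last p = 1.
-- But the y-line of E at p has no -1, so by (2) it has a single 1: second and
-- second-to-last would coincide, which is impossible for n > 3.

open import Defs
open import Data.Nat using (ℕ; zero; suc; _<_; s≤s)
import Data.Nat.Properties as ℕ
open import Data.Fin as Fin using (Fin; zero; suc; toℕ; fromℕ; inject₁)
open import Data.Fin.Properties using (toℕ-injective; suc-injective)
open import Data.Integer using (ℤ; +_; _+_; _*_; 0ℤ; 1ℤ; -1ℤ)
import Data.Integer.Properties as ℤ
open import Data.List using (List; []; _∷_; [_]; _++_; _∷ʳ_; map; foldr; reverse; tabulate; allFin)
open import Data.List.Properties
  using (filter-++; unfold-reverse; reverse-++; ++-assoc; map-tabulate)
import Data.List.Relation.Unary.All as All
open import Data.List.Relation.Unary.All.Properties using (map⁻)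
open import Data.List.Membership.Propositional.Properties using (∈-allFin)
open import Data.Product using (Σ; _×_; _,_; proj₁; proj₂)
open import Data.Sum using (_⊎_; inj₁; inj₂)
open import Data.Empty using (⊥-elim)
open import Function using (_∘_)
open import Relation.Nullary using (¬_; yes; no)
open import Relation.Binary.PropositionalEquality
  using (_≡_; _≢_; refl; sym; trans; cong; cong₂; subst; module ≡-Reasoning)

Alternating : ∀ {n} → (Fin n → ℤ) → Set
Alternating f = AltPlus (nonzeros (tabulate f))

SignLine : ∀ {n} → (Fin n → ℤ) → Set
SignLine f = (∀ k → IsSign (f k)) × Alternating f

signLine : ∀ {n} (f : Fin n → ℤ) → AltSignLine (line f) → SignLine f
signLine f (signs , alt) =
  (λ k → All.lookup (map⁻ signs) (∈-allFin k)) ,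
  subst (AltPlus ∘ nonzeros) (map-tabulate (λ k → k) f) alt

nonzeros-∷ : ∀ x xs → nonzeros (x ∷ xs) ≡ nonzeros [ x ] ++ nonzeros xs
nonzeros-∷ x xs with x ℤ.≟ 0ℤ
... | yes _ = refl
... | no _ = refl

nonzeros-[_] : ∀ x → reverse (nonzeros [ x ]) ≡ nonzeros [ x ]
nonzeros-[ x ] with x ℤ.≟ 0ℤ
... | yes _ = refl
... | no _ = refl

nonzeros-reverse : ∀ xs → nonzeros (reverse xs) ≡ reverse (nonzeros xs)
nonzeros-reverse [] = refl
nonzeros-reverse (x ∷ xs) = begin
  nonzeros (reverse (x ∷ xs))                 ≡⟨ cong nonzeros (unfold-reverse x xs) ⟩
  nonzeros (reverse xs ++ [ x ])              ≡⟨ filter-++ _ (reverse xs) [ x ] ⟩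
  nonzeros (reverse xs) ++ nonzeros [ x ]     ≡⟨ cong₂ _++_ (nonzeros-reverse xs) (sym nonzeros-[ x ]) ⟩
  reverse (nonzeros xs) ++ reverse (nonzeros [ x ])
                                              ≡⟨ sym (reverse-++ (nonzeros [ x ]) (nonzeros xs)) ⟩
  reverse (nonzeros [ x ] ++ nonzeros xs)     ≡⟨ cong reverse (sym (nonzeros-∷ x xs)) ⟩
  reverse (nonzeros (x ∷ xs))                 ∎
  where open ≡-Reasoning

altPlus-snoc : ∀ {xs} → AltPlus xs → AltPlus (xs ++ -1ℤ ∷ 1ℤ ∷ [])
altPlus-snoc single = step single
altPlus-snoc (step alt) = step (altPlus-snoc alt)

altPlus-reverse : ∀ {xs} → AltPlus xs → AltPlus (reverse xs)
altPlus-reverse single = single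
altPlus-reverse (step {xs} alt) = subst AltPlus reversed (altPlus-snoc (altPlus-reverse alt))
  where
  open ≡-Reasoning
  reversed : reverse xs ++ -1ℤ ∷ 1ℤ ∷ [] ≡ reverse (1ℤ ∷ -1ℤ ∷ xs)
  reversed = begin
    reverse xs ++ -1ℤ ∷ 1ℤ ∷ []      ≡⟨ sym (++-assoc (reverse xs) [ -1ℤ ] [ 1ℤ ]) ⟩
    (reverse xs ∷ʳ -1ℤ) ∷ʳ 1ℤ        ≡⟨ cong (_∷ʳ 1ℤ) (sym (unfold-reverse -1ℤ xs)) ⟩
    reverse (-1ℤ ∷ xs) ∷ʳ 1ℤ         ≡⟨ sym (unfold-reverse 1ℤ (-1ℤ ∷ xs)) ⟩
    reverse (1ℤ ∷ -1ℤ ∷ xs)          ∎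

tabulate-snoc : ∀ {n} (f : Fin (suc n) → ℤ) → tabulate f ≡ tabulate (f ∘ inject₁) ∷ʳ f (fromℕ n)
tabulate-snoc {zero} f = refl
tabulate-snoc {suc n} f = cong (f zero ∷_) (tabulate-snoc (f ∘ suc))

reverse-tabulate : ∀ {m} (f : Fin (suc (suc m)) → ℤ) →
  reverse (tabulate f) ≡
    f (fromℕ (suc m)) ∷ f (inject₁ (fromℕ m)) ∷ reverse (tabulate (f ∘ inject₁ ∘ inject₁))
reverse-tabulate {m} f = begin
  reverse (tabulate f)
    ≡⟨ cong reverse (tabulate-snoc f) ⟩
  reverse (tabulate (f ∘ inject₁) ∷ʳ f (fromℕ (suc m)))
    ≡⟨ reverse-++ (tabulate (f ∘ inject₁)) _ ⟩
  f (fromℕ (suc m)) ∷ reverse (tabulate (f ∘ inject₁))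
    ≡⟨ cong (λ xs → f (fromℕ (suc m)) ∷ reverse xs) (tabulate-snoc (f ∘ inject₁)) ⟩
  f (fromℕ (suc m)) ∷ reverse (tabulate (f ∘ inject₁ ∘ inject₁) ∷ʳ f (inject₁ (fromℕ m)))
    ≡⟨ cong (f (fromℕ (suc m)) ∷_) (reverse-++ (tabulate (f ∘ inject₁ ∘ inject₁)) _) ⟩
  f (fromℕ (suc m)) ∷ f (inject₁ (fromℕ m)) ∷ reverse (tabulate (f ∘ inject₁ ∘ inject₁))
    ∎
  where open ≡-Reasoning

-- The constraints an alternating sign line puts on its first two entries a, b.
OpeningPair : ℤ → ℤ → Set
OpeningPair a b = a ≢ -1ℤ × (a ≡ 0ℤ → b ≢ -1ℤ) × (a ≡ 1ℤ → b ≢ 1ℤ)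

opening : ∀ {a b rest} → AltPlus (nonzeros (a ∷ b ∷ rest)) → OpeningPair a b
opening alt = startsPositive alt , zeroThenNotNegative alt , oneThenNotOne alt
  where
  startsPositive : ∀ {a b rest} → AltPlus (nonzeros (a ∷ b ∷ rest)) → a ≢ -1ℤ
  startsPositive alt refl with alt
  ... | ()
  zeroThenNotNegative : ∀ {a b rest} → AltPlus (nonzeros (a ∷ b ∷ rest)) → a ≡ 0ℤ → b ≢ -1ℤ
  zeroThenNotNegative alt refl refl with alt
  ... | ()
  oneThenNotOne : ∀ {a b rest} → AltPlus (nonzeros (a ∷ b ∷ rest)) → a ≡ 1ℤ → b ≢ 1ℤ
  oneThenNotOne alt refl refl with alt
  ... | ()

firstPair : ∀ {m} (f : Fin (suc (suc m)) → ℤ) → Alternating f → OpeningPair (f zero) (f (suc zero))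
firstPair f = opening

lastPair : ∀ {m} (f : Fin (suc (suc m)) → ℤ) → Alternating f →
  OpeningPair (f (fromℕ (suc m))) (f (inject₁ (fromℕ m)))
lastPair f alt = opening (subst (AltPlus ∘ nonzeros) (reverse-tabulate f) reversed)
  where
  reversed : AltPlus (nonzeros (reverse (tabulate f)))
  reversed = subst AltPlus (sym (nonzeros-reverse (tabulate f))) (altPlus-reverse alt)

boundary-above-minus-one : ∀ {a b} → IsSign a → OpeningPair a b → b ≡ -1ℤ → a ≡ 1ℤ
boundary-above-minus-one (inj₁ a≡0) (_ , zeroThen , _) b≡-1 = ⊥-elim (zeroThen a≡0 b≡-1)
boundary-above-minus-one (inj₂ (inj₁ a≡1)) _ _ = a≡1
boundary-above-minus-one (inj₂ (inj₂ a≡-1)) (positive , _) _ = ⊥-elim (positive a≡-1)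

IsIndicatorOf : ∀ {n} → (Fin n → ℤ) → Fin n → Set
IsIndicatorOf f p = f p ≡ 1ℤ × (∀ q → q ≢ p → f q ≡ 0ℤ)

indicator-one-unique : ∀ {n} {f : Fin n → ℤ} {p} → IsIndicatorOf f p → ∀ q → f q ≡ 1ℤ → q ≡ p
indicator-one-unique {p = p} (_ , zeros) q fq≡1 with q Fin.≟ p
... | yes q≡p = q≡p
... | no q≢p with trans (sym (zeros q q≢p)) fq≡1
...   | ()

ZeroOne : ℤ → Set
ZeroOne x = x ≡ 0ℤ ⊎ x ≡ 1ℤ

zeroOne : ∀ {x} → IsSign x → x ≢ -1ℤ → ZeroOne x
zeroOne (inj₁ x≡0) _ = inj₁ x≡0
zeroOne (inj₂ (inj₁ x≡1)) _ = inj₂ x≡1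
zeroOne (inj₂ (inj₂ x≡-1)) x≢-1 = ⊥-elim (x≢-1 x≡-1)

nonzeros-0∷ : ∀ {x} xs → x ≡ 0ℤ → nonzeros (x ∷ xs) ≡ nonzeros xs
nonzeros-0∷ xs refl = refl

nonzeros-1∷ : ∀ {x} xs → x ≡ 1ℤ → nonzeros (x ∷ xs) ≡ 1ℤ ∷ nonzeros xs
nonzeros-1∷ xs refl = refl

zeroOne-nonzeros : ∀ {n} (f : Fin n → ℤ) → (∀ k → ZeroOne (f k)) →
  (∀ k → f k ≡ 0ℤ) ⊎ Σ (List ℤ) (λ ys → nonzeros (tabulate f) ≡ 1ℤ ∷ ys)
zeroOne-nonzeros {zero} f _ = inj₁ (λ ())
zeroOne-nonzeros {suc n} f zo with zo zero
... | inj₂ f0≡1 = inj₂ (_ , nonzeros-1∷ (tabulate (f ∘ suc)) f0≡1)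
... | inj₁ f0≡0 with zeroOne-nonzeros (f ∘ suc) (zo ∘ suc)
...   | inj₁ zeros = inj₁ λ { zero → f0≡0 ; (suc k) → zeros k }
...   | inj₂ (ys , eq) = inj₂ (ys , trans (nonzeros-0∷ (tabulate (f ∘ suc)) f0≡0) eq)

zeroOne-indicator : ∀ {n} (f : Fin n → ℤ) → (∀ k → ZeroOne (f k)) → Alternating f →
  Σ (Fin n) (IsIndicatorOf f)
zeroOne-indicator {zero} f _ ()
zeroOne-indicator {suc n} f zo alt with zo zero
... | inj₁ f0≡0 with zeroOne-indicator (f ∘ suc) (zo ∘ suc)
                       (subst AltPlus (nonzeros-0∷ (tabulate (f ∘ suc)) f0≡0) alt)
...   | p , fp≡1 , zeros = suc p , fp≡1 , λ
        { zero _ → f0≡0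
        ; (suc q) q≢p → zeros q (q≢p ∘ cong suc) }
zeroOne-indicator {suc n} f zo alt | inj₂ f0≡1 with zeroOne-nonzeros (f ∘ suc) (zo ∘ suc)
... | inj₁ zeros = zero , f0≡1 , λ
        { zero 0≢0 → ⊥-elim (0≢0 refl)
        ; (suc q) _ → zeros q }
... | inj₂ (ys , eq) = ⊥-elim (twoOnes (subst AltPlus nonzeros≡ alt))
  where
  nonzeros≡ : nonzeros (tabulate f) ≡ 1ℤ ∷ 1ℤ ∷ ys
  nonzeros≡ = trans (nonzeros-1∷ (tabulate (f ∘ suc)) f0≡1) (cong (1ℤ ∷_) eq)
  twoOnes : ¬ AltPlus (1ℤ ∷ 1ℤ ∷ ys)
  twoOnes ()

nonnegative-indicator : ∀ {n} {f : Fin n → ℤ} → SignLine f → (∀ k → f k ≢ -1ℤ) →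
  Σ (Fin n) (IsIndicatorOf f)
nonnegative-indicator {f = f} (signs , alt) nonneg =
  zeroOne-indicator f (λ k → zeroOne (signs k) (nonneg k)) alt

weight : ∀ {n} → (Fin n → ℤ) → ℤ
weight {n} f = foldr _+_ 0ℤ (map (λ k → + suc (toℕ k) * f k) (allFin n))

sum-zero : ∀ {n} (g : Fin n → ℤ) → (∀ q → g q ≡ 0ℤ) → foldr _+_ 0ℤ (tabulate g) ≡ 0ℤ
sum-zero {zero} g _ = refl
sum-zero {suc n} g zeros = cong₂ _+_ (zeros zero) (sum-zero (g ∘ suc) (zeros ∘ suc))

sum-concentrated : ∀ {n} (g : Fin n → ℤ) (p : Fin n) → (∀ q → q ≢ p → g q ≡ 0ℤ) →
  foldr _+_ 0ℤ (tabulate g) ≡ g p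
sum-concentrated g zero zeros =
  trans (cong (_+_ (g zero)) (sum-zero (g ∘ suc) (λ q → zeros (suc q) (λ ()))))
        (ℤ.+-identityʳ (g zero))
sum-concentrated g (suc p) zeros =
  trans (cong₂ _+_ (zeros zero (λ ()))
                   (sum-concentrated (g ∘ suc) p (λ q q≢p → zeros (suc q) (q≢p ∘ suc-injective))))
        (ℤ.+-identityˡ (g (suc p)))

weight-indicator : ∀ {n} {f : Fin n → ℤ} {p} → IsIndicatorOf f p → weight f ≡ + suc (toℕ p)
weight-indicator {n} {f} {p} (fp≡1 , zeros) = begin
  weight f                        ≡⟨ cong (foldr _+_ 0ℤ) (map-tabulate (λ k → k) term) ⟩
  foldr _+_ 0ℤ (tabulate term)    ≡⟨ sum-concentrated term p vanishes ⟩
  + suc (toℕ p) * f p             ≡⟨ cong (+ suc (toℕ p) *_) fp≡1 ⟩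
  + suc (toℕ p) * 1ℤ              ≡⟨ ℤ.*-identityʳ _ ⟩
  + suc (toℕ p)                   ∎
  where
  open ≡-Reasoning
  term : Fin n → ℤ
  term k = + suc (toℕ k) * f k
  vanishes : ∀ q → q ≢ p → term q ≡ 0ℤ
  vanishes q q≢p = trans (cong (+ suc (toℕ q) *_) (zeros q q≢p)) (ℤ.*-zeroʳ (+ suc (toℕ q)))

indicator-position : ∀ {n} {f g : Fin n → ℤ} {p q} →
  IsIndicatorOf f p → IsIndicatorOf g q → weight f ≡ weight g → p ≡ q
indicator-position indf indg same = toℕ-injective (ℕ.suc-injective (ℤ.+-injective
  (trans (sym (weight-indicator indf)) (trans same (weight-indicator indg)))))

-- Statement (3): g sits next to the indicator f across opening pairs and has the
-- same weight; if g(p) were not -1, g would be the indicator of p, contradicting f(p) = 1.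
forced-minus-one : ∀ {n} (f g : Fin n → ℤ) (p : Fin n) →
  (∀ k → OpeningPair (f k) (g k)) → IsIndicatorOf f p → SignLine g →
  weight g ≡ weight f → g p ≡ -1ℤ
forced-minus-one f g p pairs (fp≡1 , zeros) (signs , alt) same with g p ℤ.≟ -1ℤ
... | yes gp≡-1 = gp≡-1
... | no gp≢-1 = ⊥-elim (proj₂ (proj₂ (pairs p)) fp≡1 gp≡1)
  where
  -- Off p, f vanishes, so the opening pair keeps g from being -1 there.
  g-zeroOne : ∀ k → ZeroOne (g k)
  g-zeroOne k with k Fin.≟ p
  ... | yes refl = zeroOne (signs p) gp≢-1
  ... | no k≢p = zeroOne (signs k) (proj₁ (proj₂ (pairs k)) (zeros k k≢p))
  gp≡1 : g p ≡ 1ℤ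
  gp≡1 with zeroOne-indicator g g-zeroOne alt
  ... | q , indg = subst (λ r → g r ≡ 1ℤ) (indicator-position indg (fp≡1 , zeros) same) (proj₁ indg)

adjacent-plane-rows : ∀ {n} (E P : Fin n → Fin n → ℤ) (y₀ y₁ y₀′ y₁′ : Fin n) →
  (∀ y → SignLine (P y)) → (∀ k → SignLine (λ y → E y k)) →
  (∀ y k → OpeningPair (E y k) (P y k)) →
  (∀ k → OpeningPair (P y₀ k) (P y₁ k)) → (∀ k → OpeningPair (P y₀′ k) (P y₁′ k)) →
  y₁ ≢ y₁′ → ¬ Constant (λ y → weight (P y))
adjacent-plane-rows {n} E P y₀ y₁ y₀′ y₁′ rows cols vertical pairs pairs′ y₁≢y₁′ constant =
  y₁≢y₁′ (trans (edge-one-at y₁ (edge-one minus)) (sym (edge-one-at y₁′ (edge-one minus′))))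
  where
  -- P y₀ and P y₀′ have no -1, so each is the indicator of a position.
  start : Σ (Fin n) (IsIndicatorOf (P y₀))
  start = nonnegative-indicator (rows y₀) (proj₁ ∘ pairs)
  start′ : Σ (Fin n) (IsIndicatorOf (P y₀′))
  start′ = nonnegative-indicator (rows y₀′) (proj₁ ∘ pairs′)
  p : Fin n
  p = proj₁ start
  p′≡p : proj₁ start′ ≡ p
  p′≡p = indicator-position (proj₂ start′) (proj₂ start) (constant y₀′ y₀)
  minus : P y₁ p ≡ -1ℤ
  minus = forced-minus-one (P y₀) (P y₁) p pairs (proj₂ start) (rows y₁) (constant y₁ y₀)
  minus′ : P y₁′ p ≡ -1ℤ
  minus′ = subst (λ r → P y₁′ r ≡ -1ℤ) p′≡p
    (forced-minus-one (P y₀′) (P y₁′) _ pairs′ (proj₂ start′) (rows y₁′) (constant y₁′ y₀′))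
  edge-one : ∀ {y} → P y p ≡ -1ℤ → E y p ≡ 1ℤ
  edge-one {y} = boundary-above-minus-one (proj₁ (cols p) y) (vertical y p)
  -- The y-line of E at p has no -1, hence a single 1.
  edge : Σ (Fin n) (IsIndicatorOf (λ y → E y p))
  edge = nonnegative-indicator (cols p) (λ y → proj₁ (vertical y p))
  edge-one-at : ∀ y → E y p ≡ 1ℤ → y ≡ proj₁ edge
  edge-one-at = indicator-one-unique (proj₂ edge)

ashm-rows : ∀ m (A : HyperMatrix (suc (suc (suc (suc m))))) → IsASHM A →
  ¬ Constant (L A (suc zero)) × ¬ Constant (L A (inject₁ (fromℕ (suc (suc m)))))
ashm-rows m A (xLines , yLines , kLines) =
  adjacent-plane-rows (A zero) (A second) zero second last secondLast
    (rows second) (cols zero) (λ y k → firstPair (λ x → A x y k) (xAlt y k))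
    (yFirst second) (yLast second) (λ ()) ,
  adjacent-plane-rows (A last) (A secondLast) zero second last secondLast
    (rows secondLast) (cols last) (λ y k → lastPair (λ x → A x y k) (xAlt y k))
    (yFirst secondLast) (yLast secondLast) (λ ())
  where
  second secondLast last : Fin (suc (suc (suc (suc m))))
  second = suc zero
  secondLast = inject₁ (fromℕ (suc (suc m)))
  last = fromℕ (suc (suc (suc m)))
  rows : ∀ x y → SignLine (A x y)
  rows x y = signLine _ (kLines x y)
  cols : ∀ x k → SignLine (λ y → A x y k)
  cols x k = signLine _ (yLines x k)
  xAlt : ∀ y k → Alternating (λ x → A x y k)
  xAlt y k = proj₂ (signLine _ (xLines y k))
  yFirst : ∀ x k → OpeningPair (A x zero k) (A x second k)
  yFirst x k = firstPair (λ y → A x y k) (proj₂ (cols x k))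
  yLast : ∀ x k → OpeningPair (A x last k) (A x secondLast k)
  yLast x k = lastPair (λ y → A x y k) (proj₂ (cols x k))

transpose : ∀ {n} → HyperMatrix n → HyperMatrix n
transpose A i j k = A j i k

transpose-ASHM : ∀ {n} {A : HyperMatrix n} → IsASHM A → IsASHM (transpose A)
transpose-ASHM (xLines , yLines , kLines) = yLines , xLines , λ i j → kLines j i

corollary3p5 : (n : ℕ) → (p : 3 < n) → (A : HyperMatrix n) → IsASHM A →
    ¬ Constant (λ j → L A (secondIdx n p) j) × ¬ Constant (λ j → L A (secondLastIdx n p) j)
      × ¬ Constant (λ i → L A i (secondIdx n p)) × ¬ Constant (λ i → L A i (secondLastIdx n p))
corollary3p5 zero () _ _
corollary3p5 (suc zero) (s≤s ()) _ _
corollary3p5 (suc (suc zero)) (s≤s (s≤s ())) _ _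
corollary3p5 (suc (suc (suc zero))) (s≤s (s≤s (s≤s ()))) _ _
corollary3p5 (suc (suc (suc (suc m)))) _ A ashm =
  proj₁ rows , proj₂ rows , proj₁ columns , proj₂ columns
  where
  rows : ¬ Constant (L A (suc zero)) × ¬ Constant (L A (inject₁ (fromℕ (suc (suc m)))))
  rows = ashm-rows m A ashm
  columns : ¬ Constant (L (transpose A) (suc zero))
          × ¬ Constant (L (transpose A) (inject₁ (fromℕ (suc (suc m)))))
  columns = ashm-rows m (transpose A) (transpose-ASHM ashm)
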